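{- Let $k\ge2$. For every $N\in\{0,1,2,\dots\}$, the graph $\vec\Gamma_{k,N+1}$ is weakly isomorphic (isomorphic as oriented graphs, ignoring labels) to the line graph of $\vec\Gamma_{k,N}$.
   Context: Oriented graphs may have loops and multiple edges. The line graph $L(\vec\Gamma)$ of an oriented graph $\vec\Gamma$ has as vertex set the edge set of $\vec\Gamma$ and one edge from $e$ to $f$ whenever the terminal vertex of $e$ equals the initial vertex of $f$. $\mathcal L_k=(\mathbb Z/k\mathbb Z)\wr\mathbb Z$, $b$ the generator of $\mathbb Z$, $c$ the generator of the copy of $\mathbb Z/k\mathbb Z$ at coordinate 0, $\bar c_r=c^rb$ ($0\le r\le k-1$). $\mathcal L_k$ acts on words over $\{0,\dots,k-1\}$ by $\bar c_r.(x_1x_2\dots)=((x_1+r)(x_2+x_1)(x_3+x_2)\dots)$, additions mod $k$. $\vec\Gamma_{k,N}$ is the oriented graph with vertex set the words of length $N$ and, for each vertex $v$ and each $r$, an edge labeled $\bar c_r$ from $v$ to $\bar c_r.v$. -}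

module Defs where

open import Level using (Level; _⊔_)
open import Data.Nat using (ℕ; zero; suc; _+_)
open import Data.Nat.DivMod using (_mod_)
open import Data.Fin using (Fin; toℕ)
open import Data.Vec using (Vec; []; _∷_)
open import Data.Product using (Σ; _×_; _,_; proj₁; proj₂)
open import Function.Bundles using (_↔_; Inverse)
open import Relation.Binary.PropositionalEquality using (_≡_)

record OrientedGraph (a b : Level) : Set (Level.suc (a ⊔ b)) where
  field
    Vertex : Set a
    Edge   : Set b
    src    : Edge → Vertex
    tgt    : Edge → Vertex

open OrientedGraph public

LineGraph : ∀ {a b} → OrientedGraph a b → OrientedGraph b (a ⊔ b)
LineGraph Γ = record
  { Vertex = Edge Γ
  ; Edge   = Σ (Edge Γ × Edge Γ) (λ ef → tgt Γ (proj₁ ef) ≡ src Γ (proj₂ ef))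
  ; src    = λ p → proj₁ (proj₁ p)
  ; tgt    = λ p → proj₂ (proj₁ p)
  }

record _≅_ {a b c d} (Γ : OrientedGraph a b) (Δ : OrientedGraph c d)
       : Set (a ⊔ b ⊔ c ⊔ d) where
  field
    vertexBij : Vertex Γ ↔ Vertex Δ
    edgeBij   : Edge Γ ↔ Edge Δ
    src-comm  : ∀ e → src Δ (Inverse.to edgeBij e) ≡ Inverse.to vertexBij (src Γ e)
    tgt-comm  : ∀ e → tgt Δ (Inverse.to edgeBij e) ≡ Inverse.to vertexBij (tgt Γ e)

_+ₖ_ : ∀ {k} → Fin k → Fin k → Fin k
_+ₖ_ {suc n} x y = (toℕ x + toℕ y) mod suc n

-- Action of c̄_r = c^r b on words of length N:
-- c̄_r.(x₁x₂x₃…) = (x₁+r)(x₂+x₁)(x₃+x₂)…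
act : ∀ {k N} → Fin k → Vec (Fin k) N → Vec (Fin k) N
act r []       = []
act r (x ∷ xs) = (x +ₖ r) ∷ act x xs

-- Γ_{k,N}: vertices = words of length N over {0,…,k-1}; for each vertex v and
-- each r, an edge (v , r) (labelled c̄_r) from v to c̄_r.v.
Γ : (k N : ℕ) → OrientedGraph Level.zero Level.zero
Γ k N = record
  { Vertex = Vec (Fin k) N
  ; Edge   = Vec (Fin k) N × Fin k
  ; src    = proj₁
  ; tgt    = λ e → act (proj₂ e) (proj₁ e)
  }

module Submission where

-- A word x ∷ xs of length N + 1 is the edge (xs , x) of Γ_{k,N}, and an edge
-- (x ∷ xs , s) of Γ_{k,N+1} is the path of length two formed by (xs , x) and
-- the edge leaving its terminal vertex act x xs with label x + s.  Since
-- s ↦ x + s is a bijection of ℤ/kℤ, every such path arises exactly once.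

open import Defs
open import Data.Nat using (ℕ; suc; zero; _+_; _∸_; _%_; _≤_; _<_; NonZero)
open import Data.Nat.Properties using (+-comm; +-assoc; m+[n∸m]≡n)
open import Data.Nat.DivMod
  using (_mod_; %-distribˡ-+; m%n%n≡m%n; [m+n]%n≡m%n; m<n⇒m%n≡m; m%n<n)
open import Data.Fin using (Fin; toℕ)
open import Data.Fin.Properties using (toℕ-fromℕ<; toℕ-injective; toℕ≤n; toℕ<n)
open import Data.Vec using (Vec; []; _∷_)
open import Data.Product using (_×_; _,_)
open import Function.Bundles using (_↔_; mk↔ₛ′)
open import Relation.Binary.PropositionalEquality
  using (_≡_; refl; cong; module ≡-Reasoning)

[m%d+n]%d≡[m+n]%d : ∀ m n d .{{_ : NonZero d}} → (m % d + n) % d ≡ (m + n) % d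
[m%d+n]%d≡[m+n]%d m n d = begin
  (m % d + n) % d           ≡⟨ %-distribˡ-+ (m % d) n d ⟩
  (m % d % d + n % d) % d   ≡⟨ cong (λ z → (z + n % d) % d) (m%n%n≡m%n m d) ⟩
  (m % d + n % d) % d       ≡⟨ %-distribˡ-+ m n d ⟨
  (m + n) % d               ∎
  where open ≡-Reasoning

[m+n%d]%d≡[m+n]%d : ∀ m n d .{{_ : NonZero d}} → (m + n % d) % d ≡ (m + n) % d
[m+n%d]%d≡[m+n]%d m n d = begin
  (m + n % d) % d   ≡⟨ cong (_% d) (+-comm m (n % d)) ⟩
  (n % d + m) % d   ≡⟨ [m%d+n]%d≡[m+n]%d n m d ⟩
  (n + m) % d       ≡⟨ cong (_% d) (+-comm n m) ⟩
  (m + n) % d       ∎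
  where open ≡-Reasoning

[m+n+[d∸m]]%d≡n : ∀ {m n d} .{{_ : NonZero d}} → m ≤ d → n < d →
                  (m + n + (d ∸ m)) % d ≡ n
[m+n+[d∸m]]%d≡n {m} {n} {d} m≤d n<d = begin
  (m + n + (d ∸ m)) % d     ≡⟨ cong (λ z → (z + (d ∸ m)) % d) (+-comm m n) ⟩
  (n + m + (d ∸ m)) % d     ≡⟨ cong (_% d) (+-assoc n m (d ∸ m)) ⟩
  (n + (m + (d ∸ m))) % d   ≡⟨ cong (λ z → (n + z) % d) (m+[n∸m]≡n m≤d) ⟩
  (n + d) % d               ≡⟨ [m+n]%n≡m%n n d ⟩
  n % d                     ≡⟨ m<n⇒m%n≡m n<d ⟩
  n                         ∎
  where open ≡-Reasoning

module _ {n : ℕ} where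

  toℕ-+ₖ : (x y : Fin (suc n)) → toℕ (x +ₖ y) ≡ (toℕ x + toℕ y) % suc n
  toℕ-+ₖ x y = toℕ-fromℕ< (m%n<n (toℕ x + toℕ y) (suc n))

  infixl 6 _-ₖ_

  _-ₖ_ : Fin (suc n) → Fin (suc n) → Fin (suc n)
  r -ₖ x = (toℕ r + (suc n ∸ toℕ x)) mod suc n

  toℕ--ₖ : (r x : Fin (suc n)) → toℕ (r -ₖ x) ≡ (toℕ r + (suc n ∸ toℕ x)) % suc n
  toℕ--ₖ r x = toℕ-fromℕ< (m%n<n (toℕ r + (suc n ∸ toℕ x)) (suc n))

  x+ₖ[r-ₖx]≡r : (x r : Fin (suc n)) → x +ₖ (r -ₖ x) ≡ r
  x+ₖ[r-ₖx]≡r x r = toℕ-injective (begin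
    toℕ (x +ₖ (r -ₖ x))                       ≡⟨ toℕ-+ₖ x (r -ₖ x) ⟩
    (toℕ x + toℕ (r -ₖ x)) % d                ≡⟨ cong (λ z → (toℕ x + z) % d) (toℕ--ₖ r x) ⟩
    (toℕ x + (toℕ r + (d ∸ toℕ x)) % d) % d   ≡⟨ [m+n%d]%d≡[m+n]%d (toℕ x) _ d ⟩
    (toℕ x + (toℕ r + (d ∸ toℕ x))) % d       ≡⟨ cong (_% d) (+-assoc (toℕ x) (toℕ r) _) ⟨
    (toℕ x + toℕ r + (d ∸ toℕ x)) % d         ≡⟨ [m+n+[d∸m]]%d≡n (toℕ≤n x) (toℕ<n r) ⟩
    toℕ r                                     ∎)
    where
    open ≡-Reasoning
    d : ℕ
    d = suc n

  [x+ₖs]-ₖx≡s : (x s : Fin (suc n)) → (x +ₖ s) -ₖ x ≡ s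
  [x+ₖs]-ₖx≡s x s = toℕ-injective (begin
    toℕ ((x +ₖ s) -ₖ x)                       ≡⟨ toℕ--ₖ (x +ₖ s) x ⟩
    (toℕ (x +ₖ s) + (d ∸ toℕ x)) % d          ≡⟨ cong (λ z → (z + (d ∸ toℕ x)) % d) (toℕ-+ₖ x s) ⟩
    ((toℕ x + toℕ s) % d + (d ∸ toℕ x)) % d   ≡⟨ [m%d+n]%d≡[m+n]%d (toℕ x + toℕ s) _ d ⟩
    (toℕ x + toℕ s + (d ∸ toℕ x)) % d         ≡⟨ [m+n+[d∸m]]%d≡n (toℕ≤n x) (toℕ<n s) ⟩
    toℕ s                                     ∎)
    where
    open ≡-Reasoning
    d : ℕ
    d = suc n

module _ {n N : ℕ} where

  private
    A : Set
    A = Fin (suc n)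

  word↔edge : Vec A (suc N) ↔ Edge (Γ (suc n) N)
  word↔edge = mk↔ₛ′ to from (λ _ → refl) (λ { (x ∷ xs) → refl })
    where
    to : Vec A (suc N) → Vec A N × A
    to (x ∷ xs) = xs , x

    from : Vec A N × A → Vec A (suc N)
    from (xs , x) = x ∷ xs

  edge↔path : Edge (Γ (suc n) (suc N)) ↔ Edge (LineGraph (Γ (suc n) N))
  edge↔path = mk↔ₛ′ to from to∘from from∘to
    where
    to : Edge (Γ (suc n) (suc N)) → Edge (LineGraph (Γ (suc n) N))
    to (x ∷ xs , s) = ((xs , x) , (act x xs , x +ₖ s)) , refl

    from : Edge (LineGraph (Γ (suc n) N)) → Edge (Γ (suc n) (suc N))
    from (((xs , x) , (_ , r)) , _) = x ∷ xs , r -ₖ x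

    to∘from : ∀ p → to (from p) ≡ p
    to∘from (((xs , x) , (_ , r)) , refl) rewrite x+ₖ[r-ₖx]≡r x r = refl

    from∘to : ∀ e → from (to e) ≡ e
    from∘to (x ∷ xs , s) rewrite [x+ₖs]-ₖx≡s x s = refl

  Γ-suc≅LineGraph : Γ (suc n) (suc N) ≅ LineGraph (Γ (suc n) N)
  Γ-suc≅LineGraph = record
    { vertexBij = word↔edge
    ; edgeBij   = edge↔path
    ; src-comm  = λ { (x ∷ xs , s) → refl }
    ; tgt-comm  = λ { (x ∷ xs , s) → refl }
    }

proposition4p13 : (k : ℕ) → 2 ≤ k → (N : ℕ) → Γ k (suc N) ≅ LineGraph (Γ k N)
proposition4p13 zero    ()
proposition4p13 (suc n) _  N = Γ-suc≅LineGraph
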